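{- Let $S_1,S_2$ be finite sets and let $\pi_1,\pi_2$ be permutations of $S_1$ and $S_2$ respectively that are consistent. Then the dependency graph $G_{\{\pi_1,\pi_2\}}$ is acyclic.
   Context: A permutation of a finite set $S$ is a sequence listing each element of $S$ exactly once. The core of permutations $\pi_1$ of $S_1$ and $\pi_2$ of $S_2$ is $S_1\cap S_2$; $\pi_1$ and $\pi_2$ are consistent if there is a permutation $\pi$ of $S_1\cap S_2$ that is a subsequence of both $\pi_1$ and $\pi_2$ (equivalently, any two common elements appear in the same relative order in both). The dependency graph $G_\pi$ of a permutation $\pi=(a_1,\dots,a_\ell)$ is the directed path $v_1\to v_2\to\dots\to v_\ell$ where $v_i$ is labelled $a_i$. The dependency graph of a set of permutations is the union of their dependency graphs in which vertices carrying the same label are identified; thus $G_{\{\pi_1,\pi_2\}}$ has one vertex per element of $S_1\cup S_2$ and a directed edge $(a,b)$ whenever $b$ immediately follows $a$ in $\pi_1$ or in $\pi_2$. -}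

module Defs where

open import Data.List using (List; _∷_; _++_)
open import Data.List.Membership.Propositional using (_∈_)
open import Data.List.Relation.Unary.Unique.Propositional using (Unique)
open import Data.List.Relation.Binary.Sublist.Propositional using (_⊆_)
open import Data.Product using (Σ; ∃; ∃-syntax; _×_)
open import Data.Sum using (_⊎_)
open import Function.Bundles using (_⇔_)
open import Relation.Binary.PropositionalEquality using (_≡_)
open import Relation.Binary.Construct.Closure.Transitive using (TransClosure)
open import Relation.Nullary using (¬_)

-- A permutation of the finite set S is a duplicate-free list enumerating S.
-- We represent a permutation by its list; the underlying set S is
-- { x | x ∈ π }.
IsPermutation : {A : Set} → List A → Set
IsPermutation π = Unique π

Consistent : {A : Set} → List A → List A → Set
Consistent π₁ π₂ =
  ∃[ π ] ( Unique π
         × (∀ x → (x ∈ π) ⇔ (x ∈ π₁ × x ∈ π₂))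
         × π ⊆ π₁
         × π ⊆ π₂ )

ImmFollows : {A : Set} → List A → A → A → Set
ImmFollows π a b = ∃[ xs ] ∃[ ys ] (π ≡ xs ++ a ∷ b ∷ ys)

-- Edge relation of the dependency graph G_{π1,π2}; vertices are the labels
-- (elements of S1 ∪ S2), identified by label.
DepEdge : {A : Set} → List A → List A → A → A → Set
DepEdge π₁ π₂ a b = ImmFollows π₁ a b ⊎ ImmFollows π₂ a b

Acyclic : {A : Set} → (A → A → Set) → Set
Acyclic {A} E = ∀ (v : A) → ¬ TransClosure E v v

-- Induct along a merge of π₁ and π₂ guided by their common subsequence π:
-- the next vertex is the head of π₁ (if it is not in π₂), the head of π₂ (if
-- it is not in π₁), or the common head of both.  In each case that vertex has
-- no incoming edge, because it heads every duplicate-free list containing it.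
-- A cycle never passes through a vertex without incoming edges, so removing
-- the vertex from the lists cannot destroy a cycle; and the graph of two
-- empty lists has no edges.
module Submission where

open import Data.List using (List; []; _∷_)
open import Data.List.Membership.Propositional using (_∈_; _∉_)
open import Data.List.Membership.Propositional.Properties using (∈-++⁺ʳ)
open import Data.List.Relation.Binary.Sublist.Propositional using (_⊆_; []; _∷ʳ_; _∷_)
open import Data.List.Relation.Binary.Sublist.Propositional.Properties using (Any-resp-⊆)
open import Data.List.Relation.Unary.Any using (here; there)
open import Data.List.Relation.Unary.Unique.Propositional using (Unique; _∷_)
open import Data.List.Relation.Unary.Unique.Propositional.Properties using (Unique[x∷xs]⇒x∉xs)
open import Data.Product using (∃-syntax; _,_; proj₂)
open import Data.Sum using (_⊎_; inj₁; inj₂; [_,_]′; map₂; swap)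
open import Function using (_∘_)
open import Function.Bundles using (Equivalence)
open import Relation.Binary.Construct.Closure.Transitive using (TransClosure; [_]; _∷_)
open import Relation.Binary.PropositionalEquality using (_≡_; refl)
open import Relation.Nullary using (¬_; contradiction)

open import Defs

private
  variable
    A : Set
    a b x y : A
    t t₁ t₂ π π₁ π₂ : List A

⁺-last : {E : A → A → Set} → TransClosure E a b → ∃[ c ] E c b
⁺-last [ e ]   = _ , e
⁺-last (_ ∷ p) = ⁺-last p

acyclic-mono : {E E′ : A → A → Set} →
               (∀ {a b} → E a b → E′ a b) → Acyclic E′ → Acyclic E
acyclic-mono {E = E} {E′} E⇒E′ acyclic v = acyclic v ∘ map
  where
  map : TransClosure E a b → TransClosure E′ a b
  map [ e ]   = [ E⇒E′ e ]
  map (e ∷ p) = E⇒E′ e ∷ map p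

module _ {E E′ : A → A → Set} (s : A)
         (E⇒≡s⊎E′ : ∀ {a b} → E a b → a ≡ s ⊎ E′ a b)
         (s-source : ∀ {a} → ¬ E a s) where

  private
    avoid : ¬ a ≡ s → E a b → E′ a b
    avoid a≢s e with E⇒≡s⊎E′ e
    ... | inj₁ a≡s = contradiction a≡s a≢s
    ... | inj₂ e′  = e′

    ⁺-avoid : ¬ a ≡ s → TransClosure E a b → TransClosure E′ a b
    ⁺-avoid a≢s [ e ]   = [ avoid a≢s e ]
    ⁺-avoid a≢s (e ∷ p) = avoid a≢s e ∷ ⁺-avoid (λ { refl → s-source e }) p

  acyclic-add-source : Acyclic E′ → Acyclic E
  acyclic-add-source acyclic v cycle = acyclic v (⁺-avoid v≢s cycle)
    where
    v≢s : ¬ v ≡ s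
    v≢s refl = s-source (proj₂ (⁺-last cycle))

ImmFollows-[] : ¬ ImmFollows [] a b
ImmFollows-[] ([]    , _ , ())
ImmFollows-[] (_ ∷ _ , _ , ())

ImmFollows-∷⁻ : ImmFollows (x ∷ t) a b → a ≡ x ⊎ ImmFollows t a b
ImmFollows-∷⁻ ([]     , ys , refl) = inj₁ refl
ImmFollows-∷⁻ (_ ∷ xs , ys , refl) = inj₂ (xs , ys , refl)

ImmFollows⇒∈ : ImmFollows π a b → b ∈ π
ImmFollows⇒∈ (xs , _ , refl) = ∈-++⁺ʳ xs (there (here refl))

Unique⇒¬ImmFollows-head : Unique (x ∷ t) → ¬ ImmFollows (x ∷ t) a x
Unique⇒¬ImmFollows-head u ([]     , ys , refl) = Unique[x∷xs]⇒x∉xs u (here refl)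
Unique⇒¬ImmFollows-head u (_ ∷ xs , ys , refl) = Unique[x∷xs]⇒x∉xs u (ImmFollows⇒∈ (xs , ys , refl))

acyclic-DepEdge-[] : Acyclic (DepEdge {A} [] [])
acyclic-DepEdge-[] v cycle = [ ImmFollows-[] , ImmFollows-[] ]′ (proj₂ (⁺-last cycle))

acyclic-DepEdge-∷ˡ : Unique (y ∷ t) → y ∉ π₂ →
                     Acyclic (DepEdge t π₂) → Acyclic (DepEdge (y ∷ t) π₂)
acyclic-DepEdge-∷ˡ {y = y} {t = t} {π₂ = π₂} u y∉π₂ = acyclic-add-source y split source
  where
  split : DepEdge (y ∷ t) π₂ a b → a ≡ y ⊎ DepEdge t π₂ a b
  split = [ map₂ inj₁ ∘ ImmFollows-∷⁻ , inj₂ ∘ inj₂ ]′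
  source : ¬ DepEdge (y ∷ t) π₂ a y
  source = [ Unique⇒¬ImmFollows-head u , y∉π₂ ∘ ImmFollows⇒∈ ]′

acyclic-DepEdge-∷ʳ : Unique (y ∷ t) → y ∉ π₁ →
                     Acyclic (DepEdge π₁ t) → Acyclic (DepEdge π₁ (y ∷ t))
acyclic-DepEdge-∷ʳ u y∉π₁ = acyclic-mono swap ∘ acyclic-DepEdge-∷ˡ u y∉π₁ ∘ acyclic-mono swap

acyclic-DepEdge-∷ : Unique (x ∷ t₁) → Unique (x ∷ t₂) →
                    Acyclic (DepEdge t₁ t₂) → Acyclic (DepEdge (x ∷ t₁) (x ∷ t₂))
acyclic-DepEdge-∷ {x = x} {t₁ = t₁} {t₂ = t₂} u₁ u₂ = acyclic-add-source x split source
  where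
  split : DepEdge (x ∷ t₁) (x ∷ t₂) a b → a ≡ x ⊎ DepEdge t₁ t₂ a b
  split = [ map₂ inj₁ ∘ ImmFollows-∷⁻ , map₂ inj₂ ∘ ImmFollows-∷⁻ ]′
  source : ¬ DepEdge (x ∷ t₁) (x ∷ t₂) a x
  source = [ Unique⇒¬ImmFollows-head u₁ , Unique⇒¬ImmFollows-head u₂ ]′

ContainsCore : List A → List A → List A → Set
ContainsCore π π₁ π₂ = ∀ {z} → z ∈ π₁ → z ∈ π₂ → z ∈ π

ContainsCore-∷⁻ : Unique (x ∷ t₁) → ContainsCore (x ∷ π) (x ∷ t₁) (x ∷ t₂) →
                  ContainsCore π t₁ t₂
ContainsCore-∷⁻ u₁ core m₁ m₂ with core (there m₁) (there m₂)
... | here refl = contradiction m₁ (Unique[x∷xs]⇒x∉xs u₁)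
... | there m   = m

skipped-head-∉ : Unique (y ∷ t) → π ⊆ t → ContainsCore π (y ∷ t) π₂ → y ∉ π₂
skipped-head-∉ u p core = Unique[x∷xs]⇒x∉xs u ∘ Any-resp-⊆ p ∘ core (here refl)

acyclic-DepEdge-⊆ : π ⊆ π₁ → π ⊆ π₂ → ContainsCore π π₁ π₂ →
                    Unique π₁ → Unique π₂ → Acyclic (DepEdge π₁ π₂)
acyclic-DepEdge-⊆ (_ ∷ʳ p₁) p₂ core u₁@(_ ∷ u₁′) u₂ =
  acyclic-DepEdge-∷ˡ u₁ (skipped-head-∉ u₁ p₁ core)
    (acyclic-DepEdge-⊆ p₁ p₂ (core ∘ there) u₁′ u₂)
acyclic-DepEdge-⊆ p₁ (_ ∷ʳ p₂) core u₁ u₂@(_ ∷ u₂′) =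
  acyclic-DepEdge-∷ʳ u₂ (skipped-head-∉ u₂ p₂ (λ m₂ m₁ → core m₁ m₂))
    (acyclic-DepEdge-⊆ p₁ p₂ (λ m₁ → core m₁ ∘ there) u₁ u₂′)
acyclic-DepEdge-⊆ (refl ∷ p₁) (refl ∷ p₂) core u₁@(_ ∷ u₁′) u₂@(_ ∷ u₂′) =
  acyclic-DepEdge-∷ u₁ u₂ (acyclic-DepEdge-⊆ p₁ p₂ (ContainsCore-∷⁻ u₁ core) u₁′ u₂′)
acyclic-DepEdge-⊆ [] [] _ _ _ = acyclic-DepEdge-[]

lemma7 : {A : Set} (π₁ π₂ : List A) →
         IsPermutation π₁ → IsPermutation π₂ →
         Consistent π₁ π₂ →
         Acyclic (DepEdge π₁ π₂)
lemma7 π₁ π₂ u₁ u₂ (π , _ , core , p₁ , p₂) =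
  acyclic-DepEdge-⊆ p₁ p₂ (λ m₁ m₂ → Equivalence.from (core _) (m₁ , m₂)) u₁ u₂
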